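{- Let $u,w$ be finite words over the positive integers with $uw\equiv wu$ (Knuth equivalence), and let $b$ be a positive integer that does not occur in $u$. Then $$\alpha_b(P(wu))=\alpha_b(P(w))=\alpha_b(P(uw)).$$
   Context: For a word $v$ over the positive integers, $P(v)$ denotes its RSK insertion tableau (rows numbered from the top). Two words are Knuth equivalent, $v\equiv w$, iff one can be obtained from the other by a sequence of Knuth transpositions $xacby\leftrightarrow xcaby$ with $a\le b<c$, and $xbacy\leftrightarrow xbcay$ with $a<b\le c$; equivalently $P(v)=P(w)$. For a semistandard Young tableau $P$ with rows $R_1,R_2,\ldots$, $\alpha_b(P)$ is the sequence $(m_b(R_1),m_b(R_2),\ldots)$ where $m_b(R)$ is the number of entries of $R$ equal to $b$. -}

module Defs where

open import Data.Nat using (ℕ; zero; suc; _≤_; _<_; _≤ᵇ_; _≡ᵇ_)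
open import Data.Bool using (Bool; true; false; if_then_else_)
open import Data.List using (List; []; _∷_; _++_; [_]; foldl; length)
open import Data.Product using (_×_; _,_)
open import Data.Maybe using (Maybe; just; nothing)

-- Words over the positive integers are lists of naturals; positivity is
-- imposed as a hypothesis in the statement.
Word : Set
Word = List ℕ

-- A tableau is its list of rows, top row first; each row is weakly increasing.
Tableau : Set
Tableau = List (List ℕ)

rowInsert : ℕ → List ℕ → List ℕ × Maybe ℕ
rowInsert x [] = (x ∷ [] , nothing)
rowInsert x (y ∷ ys) with suc x ≤ᵇ y
... | true  = (x ∷ ys , just y)
... | false with rowInsert x ys
...   | (ys' , m) = (y ∷ ys' , m)

insert : ℕ → Tableau → Tableau
insert x [] = (x ∷ []) ∷ []
insert x (r ∷ rs) with rowInsert x r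
... | (r' , nothing) = r' ∷ rs
... | (r' , just y)  = r' ∷ insert y rs

P : Word → Tableau
P v = foldl (λ T x → insert x T) [] v

data KnuthStep : Word → Word → Set where
  k1  : ∀ x y a b c → a ≤ b → b < c →
        KnuthStep (x ++ a ∷ c ∷ b ∷ y) (x ++ c ∷ a ∷ b ∷ y)
  k1' : ∀ x y a b c → a ≤ b → b < c →
        KnuthStep (x ++ c ∷ a ∷ b ∷ y) (x ++ a ∷ c ∷ b ∷ y)
  k2  : ∀ x y a b c → a < b → b ≤ c →
        KnuthStep (x ++ b ∷ a ∷ c ∷ y) (x ++ b ∷ c ∷ a ∷ y)
  k2' : ∀ x y a b c → a < b → b ≤ c →
        KnuthStep (x ++ b ∷ c ∷ a ∷ y) (x ++ b ∷ a ∷ c ∷ y)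

data _≡K_ : Word → Word → Set where
  K-refl : ∀ {v} → v ≡K v
  K-step : ∀ {u v w} → KnuthStep u v → v ≡K w → u ≡K w

count : ℕ → List ℕ → ℕ
count b [] = 0
count b (y ∷ ys) = if b ≡ᵇ y then suc (count b ys) else count b ys

-- α_b(T) as the infinite sequence (m_b(R_1), m_b(R_2), …), indexed from 0,
-- where nonexistent rows are empty (contribute 0).
α : ℕ → Tableau → ℕ → ℕ
α b [] i = 0
α b (r ∷ rs) zero = count b r
α b (r ∷ rs) (suc i) = α b rs i

{-# OPTIONS --safe #-}
-- Let N_n(T) (countTop b T n) be the number of entries b in the top n rows of T;
-- α_b(T) is recovered from these partial sums.  Inserting a letter x raises each
-- N_n by at most [x = b], so N_n(P(wu)) ≤ N_n(P(w)) because b does not occur in u.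
-- Inserting a weakly increasing word into a row keeps all its b's in that row and
-- bumps out a weakly increasing word; applied row by row to the reading word of
-- P(w), which is Knuth equivalent to w, this gives
-- N_n(P(w)) ≤ N_n(P(u · readingWord (P w))) = N_n(P(uw)).  Knuth equivalent words
-- have the same P (a Knuth move in the inserted word leaves the first row unchanged
-- and changes the bumped word by at most one Knuth move), so P(uw) = P(wu) and the
-- chain N_n(P(wu)) ≤ N_n(P(w)) ≤ N_n(P(uw)) = N_n(P(wu)) collapses.
module Submission where

open import Defs
open import Data.Nat using (ℕ; zero; suc; _≤_; _<_; _≤ᵇ_; _≡ᵇ_; _+_; z≤n)
open import Data.Nat.Properties
open import Algebra.Properties.CommutativeSemigroup +-commutativeSemigroup
  using (xy∙z≈zy∙x; x∙yz≈y∙xz; x∙yz≈yx∙z; xy∙z≈xz∙y; xy∙z≈x∙zy)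
open import Data.Bool using (true; false; T)
open import Data.Empty using (⊥-elim)
open import Data.List using (List; []; _∷_; _++_; [_]; foldl; fromMaybe)
open import Data.List.Properties using (foldl-++; ++-assoc; ++-identityʳ)
open import Data.List.Membership.Propositional using (_∈_; _∉_)
open import Data.List.Relation.Unary.All as All using (All; []; _∷_)
open import Data.List.Relation.Unary.All.Properties using (++⁺)
open import Data.List.Relation.Unary.AllPairs using (AllPairs; []; _∷_)
open import Data.List.Relation.Unary.Any using (here; there)
open import Data.Maybe using (Maybe; just; nothing)
open import Data.Product using (_×_; _,_; proj₁; proj₂; map₁; map₂; ∃₂)
open import Data.Sum using (inj₁; inj₂)
open import Data.Unit using (tt)
open import Function using (_∘_)
open import Relation.Binary.Bundles using (Preorder)
open import Relation.Binary.Construct.Closure.Reflexive as Refl using (ReflClosure; refl)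
open import Relation.Binary.Construct.Closure.Symmetric using (SymClosure; fwd; bwd)
open import Relation.Binary.PropositionalEquality hiding ([_])
import Relation.Binary.Reasoning.Preorder as PreorderReasoning

-- Row insertion

Sorted : List ℕ → Set
Sorted = AllPairs _≤_

RowsSorted : Tableau → Set
RowsSorted = All Sorted

newRow : ℕ → List ℕ → List ℕ
newRow x R = proj₁ (rowInsert x R)

bumped : ℕ → List ℕ → Maybe ℕ
bumped x R = proj₂ (rowInsert x R)

rowInsert-< : ∀ {x y} ys → x < y → rowInsert x (y ∷ ys) ≡ (x ∷ ys , just y)
rowInsert-< {x} {y} ys x<y with suc x ≤ᵇ y | ≤⇒≤ᵇ x<y
... | true | _ = refl

rowInsert-≥ : ∀ {x y} ys → y ≤ x → rowInsert x (y ∷ ys) ≡ (y ∷ newRow x ys , bumped x ys)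
rowInsert-≥ {x} {y} ys y≤x with suc x ≤ᵇ y in eq
... | true  = ⊥-elim (<⇒≱ (≤ᵇ⇒≤ (suc x) y (subst T (sym eq) tt)) y≤x)
... | false = refl

newRow-all : ∀ {Q : ℕ → Set} x R → All Q R → Q x → All Q (newRow x R)
newRow-all x [] [] qx = qx ∷ []
newRow-all x (y ∷ ys) (qy ∷ qys) qx with <-≤-connex x y
... | inj₁ x<y rewrite rowInsert-< ys x<y = qx ∷ qys
... | inj₂ y≤x rewrite rowInsert-≥ ys y≤x = qy ∷ newRow-all x ys qys qx

x∈newRow : ∀ x R → x ∈ newRow x R
x∈newRow x [] = here refl
x∈newRow x (y ∷ ys) with <-≤-connex x y
... | inj₁ x<y rewrite rowInsert-< ys x<y = here refl
... | inj₂ y≤x rewrite rowInsert-≥ ys y≤x = there (x∈newRow x ys)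

bumped-∈ : ∀ x R {g} → bumped x R ≡ just g → g ∈ R
bumped-∈ x [] ()
bumped-∈ x (y ∷ ys) with <-≤-connex x y
... | inj₁ x<y rewrite rowInsert-< ys x<y = λ { refl → here refl }
... | inj₂ y≤x rewrite rowInsert-≥ ys y≤x = λ eq → there (bumped-∈ x ys eq)

bumped-> : ∀ x R {g} → bumped x R ≡ just g → x < g
bumped-> x [] ()
bumped-> x (y ∷ ys) with <-≤-connex x y
... | inj₁ x<y rewrite rowInsert-< ys x<y = λ { refl → x<y }
... | inj₂ y≤x rewrite rowInsert-≥ ys y≤x = bumped-> x ys

bumped-least : ∀ x R {g} → Sorted R → bumped x R ≡ just g → All (λ e → x < e → g ≤ e) R
bumped-least x [] _ ()
bumped-least x (y ∷ ys) (y≤ys ∷ sorted) with <-≤-connex x y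
... | inj₁ x<y rewrite rowInsert-< ys x<y = λ { refl → (λ _ → ≤-refl) ∷ All.map (λ y≤e _ → y≤e) y≤ys }
... | inj₂ y≤x rewrite rowInsert-≥ ys y≤x = λ eq → (λ x<y → ⊥-elim (<⇒≱ x<y y≤x)) ∷ bumped-least x ys sorted eq

no-bump⇒appended : ∀ x R → bumped x R ≡ nothing → newRow x R ≡ R ++ [ x ]
no-bump⇒appended x [] _ = refl
no-bump⇒appended x (y ∷ ys) with <-≤-connex x y
... | inj₁ x<y rewrite rowInsert-< ys x<y = λ ()
... | inj₂ y≤x rewrite rowInsert-≥ ys y≤x = λ eq → cong (y ∷_) (no-bump⇒appended x ys eq)

no-bump⇒all≤ : ∀ x R → bumped x R ≡ nothing → All (_≤ x) R
no-bump⇒all≤ x [] _ = []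
no-bump⇒all≤ x (y ∷ ys) with <-≤-connex x y
... | inj₁ x<y rewrite rowInsert-< ys x<y = λ ()
... | inj₂ y≤x rewrite rowInsert-≥ ys y≤x = λ eq → y≤x ∷ no-bump⇒all≤ x ys eq

all≤⇒no-bump : ∀ x R → All (_≤ x) R → bumped x R ≡ nothing
all≤⇒no-bump x [] _ = refl
all≤⇒no-bump x (y ∷ ys) (y≤x ∷ ys≤x) rewrite rowInsert-≥ ys y≤x = all≤⇒no-bump x ys ys≤x

newRow-sorted : ∀ x R → Sorted R → Sorted (newRow x R)
newRow-sorted x [] [] = [] ∷ []
newRow-sorted x (y ∷ ys) (y≤ys ∷ sorted) with <-≤-connex x y
... | inj₁ x<y rewrite rowInsert-< ys x<y = All.map (≤-trans (<⇒≤ x<y)) y≤ys ∷ sorted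
... | inj₂ y≤x rewrite rowInsert-≥ ys y≤x = newRow-all x ys y≤ys y≤x ∷ newRow-sorted x ys sorted

newRow-head : ∀ y R → ∃₂ λ hd tl → newRow y R ≡ hd ∷ tl × hd ≤ y
newRow-head y []       = y , [] , refl , ≤-refl
newRow-head y (z ∷ zs) with <-≤-connex y z
... | inj₁ y<z rewrite rowInsert-< zs y<z = y , zs , refl , ≤-refl
... | inj₂ z≤y rewrite rowInsert-≥ zs z≤y = z , newRow y zs , refl , z≤y

count-++ : ∀ b xs ys → count b (xs ++ ys) ≡ count b xs + count b ys
count-++ b [] ys = refl
count-++ b (x ∷ xs) ys with b ≡ᵇ x
... | true  = cong suc (count-++ b xs ys)
... | false = count-++ b xs ys

count-∷ : ∀ b x xs → count b (x ∷ xs) ≡ count b [ x ] + count b xs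
count-∷ b x xs = count-++ b [ x ] xs

count-≢ : ∀ {b x} → b ≢ x → count b [ x ] ≡ 0
count-≢ {b} {x} b≢x with b ≡ᵇ x in eq
... | true  = ⊥-elim (b≢x (≡ᵇ⇒≡ b x (subst T (sym eq) tt)))
... | false = refl

count-∉ : ∀ {b} xs → b ∉ xs → count b xs ≡ 0
count-∉ [] _ = refl
count-∉ {b} (x ∷ xs) b∉ = begin
  count b (x ∷ xs)             ≡⟨ count-∷ b x xs ⟩
  count b [ x ] + count b xs   ≡⟨ cong₂ _+_ (count-≢ (b∉ ∘ here)) (count-∉ xs (b∉ ∘ there)) ⟩
  0                            ∎
  where open ≡-Reasoning

rowInsert-count : ∀ b x R → count b (newRow x R) + count b (fromMaybe (bumped x R)) ≡ count b R + count b [ x ]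
rowInsert-count b x [] = +-comm (count b [ x ]) 0
rowInsert-count b x (y ∷ ys) with <-≤-connex x y
... | inj₁ x<y rewrite rowInsert-< ys x<y | count-∷ b x ys | count-∷ b y ys =
  xy∙z≈zy∙x (count b [ x ]) (count b ys) (count b [ y ])
... | inj₂ y≤x rewrite rowInsert-≥ ys y≤x | count-∷ b y (newRow x ys) | count-∷ b y ys = begin
  count b [ y ] + count b (newRow x ys) + count b (fromMaybe (bumped x ys))
    ≡⟨ +-assoc (count b [ y ]) _ _ ⟩
  count b [ y ] + (count b (newRow x ys) + count b (fromMaybe (bumped x ys)))
    ≡⟨ cong (count b [ y ] +_) (rowInsert-count b x ys) ⟩
  count b [ y ] + (count b ys + count b [ x ])
    ≡⟨ +-assoc (count b [ y ]) _ _ ⟨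
  count b [ y ] + count b ys + count b [ x ]
    ∎
  where open ≡-Reasoning

-- Inserting a word

rowInsertWord : Word → List ℕ → List ℕ × Word
rowInsertWord [] R = R , []
rowInsertWord (x ∷ s) R =
  let R′ , o = rowInsertWord s (newRow x R) in R′ , fromMaybe (bumped x R) ++ o

finalRow : Word → List ℕ → List ℕ
finalRow s R = proj₁ (rowInsertWord s R)

bumpedWord : Word → List ℕ → Word
bumpedWord s R = proj₂ (rowInsertWord s R)

insertAll : Tableau → Word → Tableau
insertAll = foldl (λ T x → insert x T)

insertAll-++ : ∀ T u v → insertAll T (u ++ v) ≡ insertAll (insertAll T u) v
insertAll-++ = foldl-++ _

P-++ : ∀ u v → P (u ++ v) ≡ insertAll (P u) v
P-++ = insertAll-++ []

insert-∷ : ∀ x R T → insert x (R ∷ T) ≡ newRow x R ∷ insertAll T (fromMaybe (bumped x R))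
insert-∷ x R T with rowInsert x R
... | R′ , nothing = refl
... | R′ , just y  = refl

insertAll-∷ : ∀ s R T → insertAll (R ∷ T) s ≡ finalRow s R ∷ insertAll T (bumpedWord s R)
insertAll-∷ [] R T = refl
insertAll-∷ (x ∷ s) R T = begin
  insertAll (insert x (R ∷ T)) s
    ≡⟨ cong (λ U → insertAll U s) (insert-∷ x R T) ⟩
  insertAll (newRow x R ∷ insertAll T (fromMaybe (bumped x R))) s
    ≡⟨ insertAll-∷ s (newRow x R) _ ⟩
  finalRow s (newRow x R) ∷ insertAll (insertAll T (fromMaybe (bumped x R))) (bumpedWord s (newRow x R))
    ≡⟨ cong (_ ∷_) (insertAll-++ T (fromMaybe (bumped x R)) _) ⟨
  finalRow (x ∷ s) R ∷ insertAll T (bumpedWord (x ∷ s) R)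
    ∎
  where open ≡-Reasoning

insert-sorted : ∀ x T → RowsSorted T → RowsSorted (insert x T)
insert-sorted x [] [] = ([] ∷ []) ∷ []
insert-sorted x (R ∷ T) (sR ∷ sT) rewrite insert-∷ x R T with bumped x R
... | nothing = newRow-sorted x R sR ∷ sT
... | just y  = newRow-sorted x R sR ∷ insert-sorted y T sT

insertAll-sorted : ∀ T s → RowsSorted T → RowsSorted (insertAll T s)
insertAll-sorted T [] sT = sT
insertAll-sorted T (x ∷ s) sT = insertAll-sorted (insert x T) s (insert-sorted x T sT)

P-sorted : ∀ v → RowsSorted (P v)
P-sorted v = insertAll-sorted [] v []

bumpedWord-all≥ : ∀ {x g} s R → Sorted s → All (x ≤_) s → All (λ e → x < e → g ≤ e) R →
                  All (g ≤_) (bumpedWord s R)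
bumpedWord-all≥ [] R _ _ _ = []
bumpedWord-all≥ {x} {g} (x′ ∷ s) R (x′≤s ∷ sorted) (x≤x′ ∷ _) least =
  ++⁺ first (bumpedWord-all≥ s (newRow x′ R) sorted x′≤s least′)
  where
  first : All (g ≤_) (fromMaybe (bumped x′ R))
  first with bumped x′ R in eq
  ... | nothing = []
  ... | just g′ = All.lookup least (bumped-∈ x′ R eq) (≤-<-trans x≤x′ (bumped-> x′ R eq)) ∷ []
  least′ : All (λ e → x′ < e → g ≤ e) (newRow x′ R)
  least′ = newRow-all x′ R (All.map (λ g≤e x′<e → g≤e (≤-<-trans x≤x′ x′<e)) least)
                          (⊥-elim ∘ <-irrefl refl)

bumpedWord-sorted : ∀ s R → Sorted R → Sorted s → Sorted (bumpedWord s R)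
bumpedWord-sorted [] R _ _ = []
bumpedWord-sorted (x ∷ s) R sR (x≤s ∷ sorted) with bumped x R in eq
... | nothing = bumpedWord-sorted s (newRow x R) (newRow-sorted x R sR) sorted
... | just g  = bumpedWord-all≥ s (newRow x R) sorted x≤s least
              ∷ bumpedWord-sorted s (newRow x R) (newRow-sorted x R sR) sorted
  where
  least : All (λ e → x < e → g ≤ e) (newRow x R)
  least = newRow-all x R (bumped-least x R sR eq) (⊥-elim ∘ <-irrefl refl)

-- Entries b in the top rows

countTop : ℕ → Tableau → ℕ → ℕ
countTop b []      n       = 0
countTop b (R ∷ T) zero    = 0
countTop b (R ∷ T) (suc n) = count b R + countTop b T n

countTop-suc : ∀ b T i → countTop b T (suc i) ≡ countTop b T i + α b T i
countTop-suc b []           i       = refl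
countTop-suc b (R ∷ [])     zero    = +-identityʳ (count b R)
countTop-suc b (R ∷ _ ∷ _)  zero    = +-identityʳ (count b R)
countTop-suc b (R ∷ T)      (suc i) = begin
  count b R + countTop b T (suc i)    ≡⟨ cong (count b R +_) (countTop-suc b T i) ⟩
  count b R + (countTop b T i + α b T i) ≡⟨ +-assoc (count b R) _ _ ⟨
  count b R + countTop b T i + α b T i ∎
  where open ≡-Reasoning

α-cong : ∀ b A B → (∀ n → countTop b A n ≡ countTop b B n) → ∀ i → α b A i ≡ α b B i
α-cong b A B eq i = +-cancelˡ-≡ (countTop b A i) _ _ (begin
  countTop b A i + α b A i  ≡⟨ countTop-suc b A i ⟨
  countTop b A (suc i)      ≡⟨ eq (suc i) ⟩
  countTop b B (suc i)      ≡⟨ countTop-suc b B i ⟩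
  countTop b B i + α b B i  ≡⟨ cong (_+ α b B i) (eq i) ⟨
  countTop b A i + α b B i  ∎)
  where open ≡-Reasoning

countTop-insert : ∀ b x T n → countTop b (insert x T) n ≤ countTop b T n + count b [ x ]
countTop-insert b x []      zero    = z≤n
countTop-insert b x []      (suc n) = ≤-reflexive (+-identityʳ (count b [ x ]))
countTop-insert b x (R ∷ T) zero    rewrite insert-∷ x R T = z≤n
countTop-insert b x (R ∷ T) (suc n) rewrite insert-∷ x R T = begin
  count b (newRow x R) + countTop b (insertAll T (fromMaybe (bumped x R))) n
    ≤⟨ +-monoʳ-≤ (count b (newRow x R)) (insertBumped (bumped x R)) ⟩
  count b (newRow x R) + (countTop b T n + count b (fromMaybe (bumped x R)))
    ≡⟨ x∙yz≈y∙xz (count b (newRow x R)) (countTop b T n) (count b (fromMaybe (bumped x R))) ⟩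
  countTop b T n + (count b (newRow x R) + count b (fromMaybe (bumped x R)))
    ≡⟨ cong (countTop b T n +_) (rowInsert-count b x R) ⟩
  countTop b T n + (count b R + count b [ x ])
    ≡⟨ x∙yz≈yx∙z (countTop b T n) (count b R) (count b [ x ]) ⟩
  count b R + countTop b T n + count b [ x ]
    ∎
  where
  open ≤-Reasoning
  insertBumped : ∀ m → countTop b (insertAll T (fromMaybe m)) n ≤ countTop b T n + count b (fromMaybe m)
  insertBumped nothing  = ≤-reflexive (sym (+-identityʳ _))
  insertBumped (just g) = countTop-insert b g T n

countTop-insertAll : ∀ b T v n → countTop b (insertAll T v) n ≤ countTop b T n + count b v
countTop-insertAll b T []      n = ≤-reflexive (sym (+-identityʳ _))
countTop-insertAll b T (x ∷ v) n = begin
  countTop b (insertAll (insert x T) v) n      ≤⟨ countTop-insertAll b (insert x T) v n ⟩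
  countTop b (insert x T) n + count b v        ≤⟨ +-monoˡ-≤ (count b v) (countTop-insert b x T n) ⟩
  countTop b T n + count b [ x ] + count b v   ≡⟨ +-assoc (countTop b T n) _ _ ⟩
  countTop b T n + (count b [ x ] + count b v) ≡⟨ cong (countTop b T n +_) (count-∷ b x v) ⟨
  countTop b T n + count b (x ∷ v)             ∎
  where open ≤-Reasoning

count-bumped-≥ : ∀ b x R → b ≤ x → count b (fromMaybe (bumped x R)) ≡ 0
count-bumped-≥ b x R b≤x with bumped x R in eq
... | nothing = refl
... | just g  = count-≢ (λ b≡g → <-irrefl b≡g (≤-<-trans b≤x (bumped-> x R eq)))

count-newRow-≥ : ∀ b x R → b ≤ x → count b (newRow x R) ≡ count b R + count b [ x ]
count-newRow-≥ b x R b≤x = begin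
  count b (newRow x R)                                         ≡⟨ +-identityʳ _ ⟨
  count b (newRow x R) + 0                                     ≡⟨ cong (count b (newRow x R) +_) (count-bumped-≥ b x R b≤x) ⟨
  count b (newRow x R) + count b (fromMaybe (bumped x R))      ≡⟨ rowInsert-count b x R ⟩
  count b R + count b [ x ]                                    ∎
  where open ≡-Reasoning

count-finalRow-≥ : ∀ b y R → All (b ≤_) y → count b (finalRow y R) ≡ count b R + count b y
count-finalRow-≥ b []      R _           = sym (+-identityʳ _)
count-finalRow-≥ b (x ∷ y) R (b≤x ∷ b≤y) = begin
  count b (finalRow y (newRow x R))       ≡⟨ count-finalRow-≥ b y (newRow x R) b≤y ⟩
  count b (newRow x R) + count b y        ≡⟨ cong (_+ count b y) (count-newRow-≥ b x R b≤x) ⟩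
  count b R + count b [ x ] + count b y   ≡⟨ +-assoc (count b R) _ _ ⟩
  count b R + (count b [ x ] + count b y) ≡⟨ cong (count b R +_) (count-∷ b x y) ⟨
  count b R + count b (x ∷ y)             ∎
  where open ≡-Reasoning

count-≤-finalRow : ∀ b y R → Sorted y → count b y ≤ count b (finalRow y R)
count-≤-finalRow b []      R _             = z≤n
count-≤-finalRow b (x ∷ y) R (x≤y ∷ sorted) with <-≤-connex x b
... | inj₁ x<b = begin
  count b (x ∷ y)                   ≡⟨ count-∷ b x y ⟩
  count b [ x ] + count b y         ≡⟨ cong (_+ count b y) (count-≢ (λ b≡x → <-irrefl (sym b≡x) x<b)) ⟩
  count b y                         ≤⟨ count-≤-finalRow b y (newRow x R) sorted ⟩
  count b (finalRow y (newRow x R)) ∎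
  where open ≤-Reasoning
... | inj₂ b≤x = begin
  count b (x ∷ y)                   ≤⟨ m≤n+m _ (count b R) ⟩
  count b R + count b (x ∷ y)       ≡⟨ count-finalRow-≥ b (x ∷ y) R (b≤x ∷ All.map (≤-trans b≤x) x≤y) ⟨
  count b (finalRow (x ∷ y) R)      ∎
  where open ≤-Reasoning

rowInsertWord-count : ∀ b s R → count b (finalRow s R) + count b (bumpedWord s R) ≡ count b R + count b s
rowInsertWord-count b []      R = refl
rowInsertWord-count b (x ∷ s) R = begin
  # F + # (m ++ o)          ≡⟨ cong (# F +_) (count-++ b m o) ⟩
  # F + (# m + # o)         ≡⟨ x∙yz≈y∙xz (# F) (# m) (# o) ⟩
  # m + (# F + # o)         ≡⟨ cong (# m +_) (rowInsertWord-count b s R′) ⟩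
  # m + (# R′ + # s)        ≡⟨ x∙yz≈yx∙z (# m) (# R′) (# s) ⟩
  # R′ + # m + # s          ≡⟨ cong (_+ # s) (rowInsert-count b x R) ⟩
  # R + # [ x ] + # s       ≡⟨ +-assoc (# R) _ _ ⟩
  # R + (# [ x ] + # s)     ≡⟨ cong (# R +_) (count-∷ b x s) ⟨
  # R + # (x ∷ s)           ∎
  where
  open ≡-Reasoning
  # : List ℕ → ℕ
  # = count b
  R′ F m o : List ℕ
  R′ = newRow x R
  F = finalRow s R′
  m = fromMaybe (bumped x R)
  o = bumpedWord s R′

countTop-insertAll-sorted : ∀ b U y → RowsSorted U → Sorted y → ∀ n →
                            countTop b U n + count b y ≤ countTop b (insertAll U y) (suc n)
countTop-insertAll-sorted b [] [] _ _ n = z≤n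
countTop-insertAll-sorted b [] (z ∷ y) _ sy n =
  -- insertAll [] (z ∷ y) is definitionally insertAll ([] ∷ []) (z ∷ y)
  subst (λ V → count b (z ∷ y) ≤ countTop b V (suc n)) (sym (insertAll-∷ (z ∷ y) [] []))
        (≤-trans (count-≤-finalRow b (z ∷ y) [] sy) (m≤m+n _ _))
countTop-insertAll-sorted b (R ∷ T) y _ sy zero rewrite insertAll-∷ y R T =
  ≤-trans (count-≤-finalRow b y R sy) (m≤m+n _ _)
countTop-insertAll-sorted b (R ∷ T) y (sR ∷ sT) sy (suc n) rewrite insertAll-∷ y R T = begin
  count b R + countTop b T n + count b y
    ≡⟨ xy∙z≈xz∙y (count b R) (countTop b T n) (count b y) ⟩
  count b R + count b y + countTop b T n
    ≡⟨ cong (_+ countTop b T n) (rowInsertWord-count b y R) ⟨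
  count b (finalRow y R) + count b (bumpedWord y R) + countTop b T n
    ≡⟨ xy∙z≈x∙zy (count b (finalRow y R)) (count b (bumpedWord y R)) (countTop b T n) ⟩
  count b (finalRow y R) + (countTop b T n + count b (bumpedWord y R))
    ≤⟨ +-monoʳ-≤ (count b (finalRow y R))
         (countTop-insertAll-sorted b T (bumpedWord y R) sT (bumpedWord-sorted y R sR sy) n) ⟩
  count b (finalRow y R) + countTop b (insertAll T (bumpedWord y R)) (suc n)
    ∎
  where open ≤-Reasoning

readingWord : Tableau → Word
readingWord []      = []
readingWord (R ∷ T) = readingWord T ++ R

countTop-insertAll-readingWord : ∀ b T U → RowsSorted T → RowsSorted U → ∀ n →
                                 countTop b T n ≤ countTop b (insertAll U (readingWord T)) n
countTop-insertAll-readingWord b []      U _         _  n       = z≤n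
countTop-insertAll-readingWord b (R ∷ T) U _         _  zero    = z≤n
countTop-insertAll-readingWord b (R ∷ T) U (sR ∷ sT) sU (suc n)
  rewrite insertAll-++ U (readingWord T) R = begin
  count b R + countTop b T n      ≡⟨ +-comm (count b R) (countTop b T n) ⟩
  countTop b T n + count b R      ≤⟨ +-monoˡ-≤ (count b R) (countTop-insertAll-readingWord b T U sT sU n) ⟩
  countTop b V n + count b R      ≤⟨ countTop-insertAll-sorted b V R (insertAll-sorted U (readingWord T) sU) sR n ⟩
  countTop b (insertAll V R) (suc n) ∎
  where
  open ≤-Reasoning
  V : Tableau
  V = insertAll U (readingWord T)

-- Knuth equivalence and reading words

≡K-trans : ∀ {u v w} → u ≡K v → v ≡K w → u ≡K w
≡K-trans K-refl          v≡w = v≡w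
≡K-trans (K-step s u≡v) v≡w = K-step s (≡K-trans u≡v v≡w)

≡K-reflexive : ∀ {u v} → u ≡ v → u ≡K v
≡K-reflexive refl = K-refl

≡K-single : ∀ {u v} → KnuthStep u v → u ≡K v
≡K-single s = K-step s K-refl

≡K-preorder : Preorder _ _ _
≡K-preorder = record
  { Carrier    = Word
  ; _≈_        = _≡_
  ; _≲_        = _≡K_
  ; isPreorder = record { isEquivalence = isEquivalence ; reflexive = ≡K-reflexive ; trans = ≡K-trans }
  }

module ≡K-Reasoning = PreorderReasoning ≡K-preorder

step-++ˡ : ∀ w {u v} → KnuthStep u v → KnuthStep (w ++ u) (w ++ v)
step-++ˡ w (k1  x y a b c p q) = subst₂ KnuthStep (++-assoc w x _) (++-assoc w x _) (k1  (w ++ x) y a b c p q)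
step-++ˡ w (k1' x y a b c p q) = subst₂ KnuthStep (++-assoc w x _) (++-assoc w x _) (k1' (w ++ x) y a b c p q)
step-++ˡ w (k2  x y a b c p q) = subst₂ KnuthStep (++-assoc w x _) (++-assoc w x _) (k2  (w ++ x) y a b c p q)
step-++ˡ w (k2' x y a b c p q) = subst₂ KnuthStep (++-assoc w x _) (++-assoc w x _) (k2' (w ++ x) y a b c p q)

step-++ʳ : ∀ w {u v} → KnuthStep u v → KnuthStep (u ++ w) (v ++ w)
step-++ʳ w (k1  x y a b c p q) = subst₂ KnuthStep (sym (++-assoc x _ w)) (sym (++-assoc x _ w)) (k1  x (y ++ w) a b c p q)
step-++ʳ w (k1' x y a b c p q) = subst₂ KnuthStep (sym (++-assoc x _ w)) (sym (++-assoc x _ w)) (k1' x (y ++ w) a b c p q)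
step-++ʳ w (k2  x y a b c p q) = subst₂ KnuthStep (sym (++-assoc x _ w)) (sym (++-assoc x _ w)) (k2  x (y ++ w) a b c p q)
step-++ʳ w (k2' x y a b c p q) = subst₂ KnuthStep (sym (++-assoc x _ w)) (sym (++-assoc x _ w)) (k2' x (y ++ w) a b c p q)

≡K-++ˡ : ∀ w {u v} → u ≡K v → (w ++ u) ≡K (w ++ v)
≡K-++ˡ w K-refl         = K-refl
≡K-++ˡ w (K-step s u≡v) = K-step (step-++ˡ w s) (≡K-++ˡ w u≡v)

≡K-++ʳ : ∀ w {u v} → u ≡K v → (u ++ w) ≡K (v ++ w)
≡K-++ʳ w K-refl         = K-refl
≡K-++ʳ w (K-step s u≡v) = K-step (step-++ʳ w s) (≡K-++ʳ w u≡v)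

≡K-moveLeft : ∀ h M y → Sorted (h ∷ M) → y < h → (h ∷ M ++ [ y ]) ≡K (h ∷ y ∷ M)
≡K-moveLeft h []      y _                      _   = K-refl
≡K-moveLeft h (m ∷ M) y ((h≤m ∷ _) ∷ sorted) y<h =
  ≡K-trans (≡K-++ˡ [ h ] (≡K-moveLeft m M y sorted (<-≤-trans y<h h≤m)))
           (≡K-single (k2' [] M y h m y<h h≤m))

rowInsert-≡K : ∀ y R {g} → Sorted R → bumped y R ≡ just g → (R ++ [ y ]) ≡K (g ∷ newRow y R)
rowInsert-≡K y []       _ ()
rowInsert-≡K y (r ∷ R) (r≤R ∷ sR) with <-≤-connex y r
... | inj₁ y<r rewrite rowInsert-< R y<r = λ { refl → ≡K-moveLeft r R y (r≤R ∷ sR) y<r }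
... | inj₂ r≤y rewrite rowInsert-≥ R r≤y = λ eq → ≡K-trans
  (≡K-++ˡ [ r ] (rowInsert-≡K y R sR eq))
  (swap (newRow-all y R r≤R r≤y) (newRow-head y R) (bumped-> y R eq))
  where
  swap : ∀ {g row} → All (r ≤_) row → (∃₂ λ hd tl → row ≡ hd ∷ tl × hd ≤ y) → y < g →
         (r ∷ g ∷ row) ≡K (g ∷ r ∷ row)
  swap (r≤hd ∷ _) (hd , tl , refl , hd≤y) y<g = ≡K-single (k1 [] tl r hd _ r≤hd (≤-<-trans hd≤y y<g))

readingWord-insert : ∀ y T → RowsSorted T → (readingWord T ++ [ y ]) ≡K readingWord (insert y T)
readingWord-insert y []      _         = K-refl
readingWord-insert y (R ∷ T) (sR ∷ sT) rewrite insert-∷ y R T with bumped y R in eq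
... | nothing = ≡K-reflexive (begin
  (readingWord T ++ R) ++ [ y ]  ≡⟨ ++-assoc (readingWord T) R [ y ] ⟩
  readingWord T ++ (R ++ [ y ])  ≡⟨ cong (readingWord T ++_) (no-bump⇒appended y R eq) ⟨
  readingWord T ++ newRow y R    ∎)
  where open ≡-Reasoning
... | just g  = begin
  (readingWord T ++ R) ++ [ y ]           ≡⟨ ++-assoc (readingWord T) R [ y ] ⟩
  readingWord T ++ (R ++ [ y ])           ∼⟨ ≡K-++ˡ (readingWord T) (rowInsert-≡K y R sR eq) ⟩
  readingWord T ++ (g ∷ newRow y R)       ≡⟨ ++-assoc (readingWord T) [ g ] (newRow y R) ⟨
  (readingWord T ++ [ g ]) ++ newRow y R  ∼⟨ ≡K-++ʳ (newRow y R) (readingWord-insert g T sT) ⟩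
  readingWord (insert g T) ++ newRow y R  ∎
  where open ≡K-Reasoning

readingWord-insertAll : ∀ T s → RowsSorted T → (readingWord T ++ s) ≡K readingWord (insertAll T s)
readingWord-insertAll T []      _  = ≡K-reflexive (++-identityʳ (readingWord T))
readingWord-insertAll T (x ∷ s) sT = begin
  readingWord T ++ x ∷ s                  ≡⟨ ++-assoc (readingWord T) [ x ] s ⟨
  (readingWord T ++ [ x ]) ++ s           ∼⟨ ≡K-++ʳ s (readingWord-insert x T sT) ⟩
  readingWord (insert x T) ++ s           ∼⟨ readingWord-insertAll (insert x T) s (insert-sorted x T sT) ⟩
  readingWord (insertAll (insert x T) s)  ∎
  where open ≡K-Reasoning

≡K-readingWord-P : ∀ w → w ≡K readingWord (P w)
≡K-readingWord-P w = readingWord-insertAll [] w []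

-- Knuth equivalent words have the same insertion tableau

data KnuthMove : Word → Word → Set where
  acb→cab : ∀ {a b c} → a ≤ b → b < c → KnuthMove (a ∷ c ∷ b ∷ []) (c ∷ a ∷ b ∷ [])
  bac→bca : ∀ {a b c} → a < b → b ≤ c → KnuthMove (b ∷ a ∷ c ∷ []) (b ∷ c ∷ a ∷ [])

_≈ₖ_ : Word → Word → Set
_≈ₖ_ = ReflClosure (SymClosure KnuthMove)

record _≋_ (p q : List ℕ × Word) : Set where
  field
    sameRow : proj₁ p ≡ proj₁ q
    relatedBumps : proj₂ p ≈ₖ proj₂ q

rowInsert-pass : ∀ {x y ys r} → y ≤ x → rowInsert x ys ≡ r → rowInsert x (y ∷ ys) ≡ map₁ (y ∷_) r
rowInsert-pass {ys = ys} y≤x refl = rowInsert-≥ ys y≤x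

rowInsertWord-∷ : ∀ x s R {R′ m} → rowInsert x R ≡ (R′ , m) →
                  rowInsertWord (x ∷ s) R ≡ map₂ (fromMaybe m ++_) (rowInsertWord s R′)
rowInsertWord-∷ x s R refl = refl

rowInsertWord₃ : ∀ x₁ x₂ x₃ R {R₁ R₂ R₃ m₁ m₂ m₃} →
                 rowInsert x₁ R ≡ (R₁ , m₁) → rowInsert x₂ R₁ ≡ (R₂ , m₂) → rowInsert x₃ R₂ ≡ (R₃ , m₃) →
                 rowInsertWord (x₁ ∷ x₂ ∷ x₃ ∷ []) R ≡ (R₃ , fromMaybe m₁ ++ fromMaybe m₂ ++ fromMaybe m₃ ++ [])
rowInsertWord₃ x₁ x₂ x₃ R refl refl refl = refl

≋-intro : ∀ {p₁ p₂ X o₁ o₂} → p₁ ≡ (X , o₁) → p₂ ≡ (X , o₂) → o₁ ≈ₖ o₂ → p₁ ≋ p₂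
≋-intro refl refl o₁≈o₂ = record { sameRow = refl ; relatedBumps = o₁≈o₂ }

≋-reflexive : ∀ {p q} → p ≡ q → p ≋ q
≋-reflexive refl = record { sameRow = refl ; relatedBumps = refl }

rowInsertWord-≥ : ∀ {y} s ys → All (y ≤_) s → rowInsertWord s (y ∷ ys) ≡ map₁ (y ∷_) (rowInsertWord s ys)
rowInsertWord-≥ []      ys _           = refl
rowInsertWord-≥ (x ∷ s) ys (y≤x ∷ y≤s) =
  trans (rowInsertWord-∷ x s (_ ∷ ys) (rowInsert-≥ ys y≤x))
        (cong (map₂ (fromMaybe (bumped x ys) ++_)) (rowInsertWord-≥ s (newRow x ys) y≤s))

≋-∷ : ∀ {y} s₁ s₂ ys → All (y ≤_) s₁ → All (y ≤_) s₂ → rowInsertWord s₁ ys ≋ rowInsertWord s₂ ys →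
      rowInsertWord s₁ (y ∷ ys) ≋ rowInsertWord s₂ (y ∷ ys)
≋-∷ s₁ s₂ ys y≤s₁ y≤s₂ rel
  rewrite rowInsertWord-≥ s₁ ys y≤s₁ | rowInsertWord-≥ s₂ ys y≤s₂ =
  record { sameRow = cong (_ ∷_) (_≋_.sameRow rel) ; relatedBumps = _≋_.relatedBumps rel }

rowInsertWord-[]-move : ∀ {s₁ s₂} → KnuthMove s₁ s₂ → rowInsertWord s₁ [] ≡ rowInsertWord s₂ []
rowInsertWord-[]-move (acb→cab {a} {b} {c} a≤b b<c) = trans
  (rowInsertWord₃ a c b [] refl (rowInsert-pass (≤-trans a≤b (<⇒≤ b<c)) refl) (rowInsert-pass a≤b (rowInsert-< [] b<c)))
  (sym (rowInsertWord₃ c a b [] refl (rowInsert-< [] (≤-<-trans a≤b b<c)) (rowInsert-pass a≤b refl)))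
rowInsertWord-[]-move (bac→bca {a} {b} {c} a<b b≤c) = trans
  (rowInsertWord₃ b a c [] refl (rowInsert-< [] a<b) (rowInsert-pass (≤-trans (<⇒≤ a<b) b≤c) refl))
  (sym (rowInsertWord₃ b c a [] refl (rowInsert-pass b≤c refl) (rowInsert-< (c ∷ []) a<b)))

rowInsertWord-acb→cab-< : ∀ {a b c y} ys → Sorted (y ∷ ys) → a ≤ b → b < c → a < y →
                          rowInsertWord (a ∷ c ∷ b ∷ []) (y ∷ ys) ≋ rowInsertWord (c ∷ a ∷ b ∷ []) (y ∷ ys)
rowInsertWord-acb→cab-< {a} {b} {c} {y} ys (y≤ys ∷ sys) a≤b b<c a<y with <-≤-connex c y
... | inj₂ y≤c = ≋-intro (rowInsertWord₃ a c b (y ∷ ys) (rowInsert-< ys a<y) (rowInsert-pass a≤c refl) (rowInsert-pass a≤b refl))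
                        (rowInsertWord₃ c a b (y ∷ ys) (rowInsert-pass y≤c refl) (rowInsert-< _ a<y) (rowInsert-pass a≤b refl))
                        related
  where
  a≤c : a ≤ c
  a≤c = ≤-trans a≤b (<⇒≤ b<c)
  ys₁ : List ℕ
  ys₁ = newRow c ys
  related : (y ∷ fromMaybe (bumped c ys) ++ fromMaybe (bumped b ys₁) ++ [])
         ≈ₖ (fromMaybe (bumped c ys) ++ y ∷ fromMaybe (bumped b ys₁) ++ [])
  related with bumped c ys in eqγ | bumped b ys₁ in eqβ
  ... | nothing | _       = refl
  ... | just γ  | nothing = ⊥-elim (<⇒≱ b<c (All.lookup (no-bump⇒all≤ b ys₁ eqβ) (x∈newRow c ys)))
  ... | just γ  | just β  = Refl.[ fwd (acb→cab y≤β (≤-<-trans β≤c (bumped-> c ys eqγ))) ]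
    where
    y≤β : y ≤ β
    y≤β = All.lookup (newRow-all c ys y≤ys y≤c) (bumped-∈ b ys₁ eqβ)
    β≤c : β ≤ c
    β≤c = All.lookup (bumped-least b ys₁ (newRow-sorted c ys sys) eqβ) (x∈newRow c ys) b<c
... | inj₁ c<y with ys | y≤ys
...   | []     | _       =
  ≋-intro (rowInsertWord₃ a c b (y ∷ []) (rowInsert-< [] a<y) (rowInsert-pass a≤c refl) (rowInsert-pass a≤b (rowInsert-< [] b<c)))
       (rowInsertWord₃ c a b (y ∷ []) (rowInsert-< [] c<y) (rowInsert-< [] a<c) (rowInsert-pass a≤b refl))
       refl
  where
  a≤c : a ≤ c
  a≤c = ≤-trans a≤b (<⇒≤ b<c)
  a<c : a < c
  a<c = ≤-<-trans a≤b b<c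
...   | z ∷ zs | y≤z ∷ _ =
  ≋-intro (rowInsertWord₃ a c b (y ∷ z ∷ zs) (rowInsert-< (z ∷ zs) a<y) (rowInsert-pass a≤c (rowInsert-< zs (<-≤-trans c<y y≤z)))
                       (rowInsert-pass a≤b (rowInsert-< zs b<c)))
       (rowInsertWord₃ c a b (y ∷ z ∷ zs) (rowInsert-< (z ∷ zs) c<y) (rowInsert-< (z ∷ zs) a<c)
                       (rowInsert-pass a≤b (rowInsert-< zs (<-≤-trans (<-trans b<c c<y) y≤z))))
       Refl.[ bwd (bac→bca c<y y≤z) ]
  where
  a≤c : a ≤ c
  a≤c = ≤-trans a≤b (<⇒≤ b<c)
  a<c : a < c
  a<c = ≤-<-trans a≤b b<c

rowInsertWord-acb→cab : ∀ {a b c} R → Sorted R → a ≤ b → b < c →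
                        rowInsertWord (a ∷ c ∷ b ∷ []) R ≋ rowInsertWord (c ∷ a ∷ b ∷ []) R
rowInsertWord-acb→cab [] _ a≤b b<c = ≋-reflexive (rowInsertWord-[]-move (acb→cab a≤b b<c))
rowInsertWord-acb→cab {a} {b} {c} (y ∷ ys) (y≤ys ∷ sys) a≤b b<c with <-≤-connex a y
... | inj₂ y≤a = ≋-∷ _ _ ys (y≤a ∷ y≤c ∷ y≤b ∷ []) (y≤c ∷ y≤a ∷ y≤b ∷ []) (rowInsertWord-acb→cab ys sys a≤b b<c)
  where
  y≤b : y ≤ b
  y≤b = ≤-trans y≤a a≤b
  y≤c : y ≤ c
  y≤c = ≤-trans y≤b (<⇒≤ b<c)
... | inj₁ a<y = rowInsertWord-acb→cab-< ys (y≤ys ∷ sys) a≤b b<c a<y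

rowInsertWord-bac→bca-< : ∀ {a b c y} ys → Sorted (y ∷ ys) → a < b → b ≤ c → a < y →
                          rowInsertWord (b ∷ a ∷ c ∷ []) (y ∷ ys) ≋ rowInsertWord (b ∷ c ∷ a ∷ []) (y ∷ ys)
rowInsertWord-bac→bca-< {a} {b} {c} {y} ys (y≤ys ∷ sys) a<b b≤c a<y with <-≤-connex b y
... | inj₁ b<y = ≋-intro (rowInsertWord₃ b a c (y ∷ ys) (rowInsert-< ys b<y) (rowInsert-< ys a<b) (rowInsert-pass a≤c refl))
                        (rowInsertWord₃ b c a (y ∷ ys) (rowInsert-< ys b<y) (rowInsert-pass b≤c refl) (rowInsert-< _ a<b))
                        related
  where
  a≤c : a ≤ c
  a≤c = ≤-trans (<⇒≤ a<b) b≤c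
  related : (y ∷ b ∷ fromMaybe (bumped c ys) ++ []) ≈ₖ (y ∷ fromMaybe (bumped c ys) ++ b ∷ [])
  related with bumped c ys in eqγ
  ... | nothing = refl
  ... | just γ  = Refl.[ fwd (bac→bca b<y (All.lookup y≤ys (bumped-∈ c ys eqγ))) ]
... | inj₂ y≤b = ≋-intro (rowInsertWord₃ b a c (y ∷ ys) (rowInsert-pass y≤b refl) (rowInsert-< _ a<y) (rowInsert-pass a≤c refl))
                        (rowInsertWord₃ b c a (y ∷ ys) (rowInsert-pass y≤b refl) (rowInsert-pass (≤-trans y≤b b≤c) refl) (rowInsert-< _ a<y))
                        related
  where
  a≤c : a ≤ c
  a≤c = ≤-trans (<⇒≤ a<b) b≤c
  ys₁ : List ℕ
  ys₁ = newRow b ys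
  ys₁≤c : bumped b ys ≡ nothing → All (_≤ c) ys₁
  ys₁≤c eqβ = All.map (λ e≤b → ≤-trans e≤b b≤c) (newRow-all b ys (no-bump⇒all≤ b ys eqβ) ≤-refl)
  related : (fromMaybe (bumped b ys) ++ y ∷ fromMaybe (bumped c ys₁) ++ [])
         ≈ₖ (fromMaybe (bumped b ys) ++ fromMaybe (bumped c ys₁) ++ y ∷ [])
  related with bumped b ys in eqβ
  ... | nothing rewrite all≤⇒no-bump c ys₁ (ys₁≤c eqβ) = refl
  ... | just β with bumped c ys₁ in eqγ
  ...   | nothing = refl
  ...   | just γ  = Refl.[ fwd (bac→bca (≤-<-trans y≤b (bumped-> b ys eqβ)) β≤γ) ]
    where
    β≤γ : β ≤ γ
    β≤γ = All.lookup (newRow-all b ys (bumped-least b ys sys eqβ) (⊥-elim ∘ <-irrefl refl))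
                     (bumped-∈ c ys₁ eqγ) (≤-<-trans b≤c (bumped-> c ys₁ eqγ))

rowInsertWord-bac→bca : ∀ {a b c} R → Sorted R → a < b → b ≤ c →
                        rowInsertWord (b ∷ a ∷ c ∷ []) R ≋ rowInsertWord (b ∷ c ∷ a ∷ []) R
rowInsertWord-bac→bca [] _ a<b b≤c = ≋-reflexive (rowInsertWord-[]-move (bac→bca a<b b≤c))
rowInsertWord-bac→bca {a} {b} {c} (y ∷ ys) (y≤ys ∷ sys) a<b b≤c with <-≤-connex a y
... | inj₂ y≤a = ≋-∷ _ _ ys (y≤b ∷ y≤a ∷ y≤c ∷ []) (y≤b ∷ y≤c ∷ y≤a ∷ []) (rowInsertWord-bac→bca ys sys a<b b≤c)
  where
  y≤b : y ≤ b
  y≤b = ≤-trans y≤a (<⇒≤ a<b)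
  y≤c : y ≤ c
  y≤c = ≤-trans y≤b b≤c
... | inj₁ a<y = rowInsertWord-bac→bca-< ys (y≤ys ∷ sys) a<b b≤c a<y

rowInsertWord-move : ∀ {s₁ s₂} R → Sorted R → KnuthMove s₁ s₂ → rowInsertWord s₁ R ≋ rowInsertWord s₂ R
rowInsertWord-move R sR (acb→cab a≤b b<c) = rowInsertWord-acb→cab R sR a≤b b<c
rowInsertWord-move R sR (bac→bca a<b b≤c) = rowInsertWord-bac→bca R sR a<b b≤c

insertAll-[]-move : ∀ {s₁ s₂} → KnuthMove s₁ s₂ → insertAll ([] ∷ []) s₁ ≡ insertAll ([] ∷ []) s₂
insertAll-[]-move {s₁} {s₂} m = begin
  insertAll ([] ∷ []) s₁                             ≡⟨ insertAll-∷ s₁ [] [] ⟩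
  finalRow s₁ [] ∷ insertAll [] (bumpedWord s₁ [])   ≡⟨ cong (λ p → proj₁ p ∷ insertAll [] (proj₂ p)) (rowInsertWord-[]-move m) ⟩
  finalRow s₂ [] ∷ insertAll [] (bumpedWord s₂ [])   ≡⟨ insertAll-∷ s₂ [] [] ⟨
  insertAll ([] ∷ []) s₂                             ∎
  where open ≡-Reasoning

insertAll-≈ₖ : ∀ T {s₁ s₂} → RowsSorted T → s₁ ≈ₖ s₂ → insertAll T s₁ ≡ insertAll T s₂

insertAll-move : ∀ T {s₁ s₂} → RowsSorted T → KnuthMove s₁ s₂ → insertAll T s₁ ≡ insertAll T s₂
-- On a nonempty word, inserting into [] is definitionally inserting into [] ∷ [];
-- matching the move exposes the word as nonempty.
insertAll-move [] _ m@(acb→cab _ _) = insertAll-[]-move m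
insertAll-move [] _ m@(bac→bca _ _) = insertAll-[]-move m
insertAll-move (R ∷ T) {s₁} {s₂} (sR ∷ sT) m = begin
  insertAll (R ∷ T) s₁                            ≡⟨ insertAll-∷ s₁ R T ⟩
  finalRow s₁ R ∷ insertAll T (bumpedWord s₁ R)   ≡⟨ cong₂ _∷_ sameRow (insertAll-≈ₖ T sT relatedBumps) ⟩
  finalRow s₂ R ∷ insertAll T (bumpedWord s₂ R)   ≡⟨ insertAll-∷ s₂ R T ⟨
  insertAll (R ∷ T) s₂                            ∎
  where
  open ≡-Reasoning
  open _≋_ (rowInsertWord-move R sR m)

insertAll-≈ₖ T sT refl      = refl
insertAll-≈ₖ T sT Refl.[ fwd m ] = insertAll-move T sT m
insertAll-≈ₖ T sT Refl.[ bwd m ] = sym (insertAll-move T sT m)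

P-move-in-context : ∀ x y {s₁ s₂} → KnuthMove s₁ s₂ → P (x ++ s₁ ++ y) ≡ P (x ++ s₂ ++ y)
P-move-in-context x y {s₁} {s₂} m = begin
  P (x ++ s₁ ++ y)                  ≡⟨ P-++ x (s₁ ++ y) ⟩
  insertAll (P x) (s₁ ++ y)         ≡⟨ insertAll-++ (P x) s₁ y ⟩
  insertAll (insertAll (P x) s₁) y  ≡⟨ cong (λ T → insertAll T y) (insertAll-move (P x) (P-sorted x) m) ⟩
  insertAll (insertAll (P x) s₂) y  ≡⟨ insertAll-++ (P x) s₂ y ⟨
  insertAll (P x) (s₂ ++ y)         ≡⟨ P-++ x (s₂ ++ y) ⟨
  P (x ++ s₂ ++ y)                  ∎
  where open ≡-Reasoning

P-step : ∀ {u v} → KnuthStep u v → P u ≡ P v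
P-step (k1  x y a b c a≤b b<c) = P-move-in-context x y (acb→cab a≤b b<c)
P-step (k1' x y a b c a≤b b<c) = sym (P-move-in-context x y (acb→cab a≤b b<c))
P-step (k2  x y a b c a<b b≤c) = P-move-in-context x y (bac→bca a<b b≤c)
P-step (k2' x y a b c a<b b≤c) = sym (P-move-in-context x y (bac→bca a<b b≤c))

P-resp-≡K : ∀ {u v} → u ≡K v → P u ≡ P v
P-resp-≡K K-refl         = refl
P-resp-≡K (K-step s u≡v) = trans (P-step s) (P-resp-≡K u≡v)

countTop-P-++-∉ : ∀ b u w → b ∉ u → ∀ n → countTop b (P (w ++ u)) n ≤ countTop b (P w) n
countTop-P-++-∉ b u w b∉u n = begin
  countTop b (P (w ++ u)) n         ≡⟨ cong (λ T → countTop b T n) (P-++ w u) ⟩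
  countTop b (insertAll (P w) u) n  ≤⟨ countTop-insertAll b (P w) u n ⟩
  countTop b (P w) n + count b u    ≡⟨ cong (countTop b (P w) n +_) (count-∉ u b∉u) ⟩
  countTop b (P w) n + 0            ≡⟨ +-identityʳ _ ⟩
  countTop b (P w) n                ∎
  where open ≤-Reasoning

countTop-P-++ˡ : ∀ b u w n → countTop b (P w) n ≤ countTop b (P (u ++ w)) n
countTop-P-++ˡ b u w n = begin
  countTop b (P w) n                                  ≤⟨ countTop-insertAll-readingWord b (P w) (P u) (P-sorted w) (P-sorted u) n ⟩
  countTop b (insertAll (P u) (readingWord (P w))) n  ≡⟨ cong (λ T → countTop b T n) (P-++ u (readingWord (P w))) ⟨
  countTop b (P (u ++ readingWord (P w))) n           ≡⟨ cong (λ T → countTop b T n) (P-resp-≡K (≡K-++ˡ u (≡K-readingWord-P w))) ⟨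
  countTop b (P (u ++ w)) n                           ∎
  where open ≤-Reasoning

corollary2p2 : (u w : Word) → All (λ x → 1 ≤ x) u → All (λ x → 1 ≤ x) w →
    (u ++ w) ≡K (w ++ u) → (b : ℕ) → 1 ≤ b → b ∉ u →
    (∀ i → α b (P (w ++ u)) i ≡ α b (P w) i) × (∀ i → α b (P w) i ≡ α b (P (u ++ w)) i)
corollary2p2 u w _ _ uw≡Kwu b _ b∉u = α-cong b (P (w ++ u)) (P w) wu≗w , α-cong b (P w) (P (u ++ w)) w≗uw
  where
  wu≤w : ∀ n → countTop b (P (w ++ u)) n ≤ countTop b (P w) n
  wu≤w = countTop-P-++-∉ b u w b∉u
  w≤uw : ∀ n → countTop b (P w) n ≤ countTop b (P (u ++ w)) n
  w≤uw = countTop-P-++ˡ b u w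
  uw≡wu : ∀ n → countTop b (P (u ++ w)) n ≡ countTop b (P (w ++ u)) n
  uw≡wu n = cong (λ T → countTop b T n) (P-resp-≡K uw≡Kwu)
  wu≗w : ∀ n → countTop b (P (w ++ u)) n ≡ countTop b (P w) n
  wu≗w n = ≤-antisym (wu≤w n) (≤-trans (w≤uw n) (≤-reflexive (uw≡wu n)))
  w≗uw : ∀ n → countTop b (P w) n ≡ countTop b (P (u ++ w)) n
  w≗uw n = ≤-antisym (w≤uw n) (≤-trans (≤-reflexive (uw≡wu n)) (wu≤w n))
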